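{- Let $G$ be a connected graph of order $n\ge 3$. Then the following are equivalent: (1) $rvx_3(G)=0$; (2) $sdiam_3(G)=2$; (3) $n-2\leq \delta(G)\leq n-1$, where $\delta(G)$ is the minimum degree of $G$.
   Context: All graphs are finite, simple and undirected. For $S\subseteq V(G)$ with $|S|\ge 2$, an $S$-tree is a subgraph of $G$ that is a tree containing $S$. Given a vertex-coloring of $G$, an $S$-tree $T$ is vertex-rainbow if the vertices of $V(T)\setminus S$ have pairwise distinct colors. A vertex-coloring is a $3$-vertex-rainbow coloring if every $3$-subset $S$ of $V(G)$ has a vertex-rainbow $S$-tree; $rvx_3(G)$ is the minimum number of colors of such a coloring (with $rvx_3(G)=0$ meaning every $3$-subset $S$ has an $S$-tree with vertex set exactly $S$). The Steiner distance $d(S)$ is the minimum number of edges of a connected subgraph of $G$ whose vertex set contains $S$; $sdiam_3(G)=\max\{d(S): S\subseteq V(G),|S|=3\}$. -}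

module Defs where

open import Data.Nat using (ℕ; zero; suc; _≤_; _<_; _⊓_; _<ᵇ_)
open import Data.Fin using (Fin; toℕ)
open import Data.Bool using (Bool; true; false; if_then_else_; _∧_)
open import Data.List using (List; []; _∷_; _∷ʳ_; map; foldr; allFin; length)
open import Data.Nat.ListAction using (sum)
open import Data.List.Relation.Unary.Linked using (Linked)
open import Data.List.Relation.Unary.Unique.Propositional using (Unique)
open import Data.Product using (Σ; ∃; ∃-syntax; _×_; _,_)
open import Data.Sum using (_⊎_)
open import Relation.Nullary using (¬_)
open import Relation.Binary.PropositionalEquality using (_≡_; _≢_)
open import Relation.Binary.Construct.Closure.ReflexiveTransitive using (Star)

record Graph (n : ℕ) : Set where
  field
    adj   : Fin n → Fin n → Bool
    sym   : ∀ u v → adj u v ≡ adj v u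
    irrefl : ∀ v → adj v v ≡ false
open Graph public

Adj : ∀ {n} → Graph n → Fin n → Fin n → Set
Adj G u v = adj G u v ≡ true

Connected : ∀ {n} → Graph n → Set
Connected {n} G = (u v : Fin n) → Star (Adj G) u v

countB : ∀ {n} → (Fin n → Bool) → ℕ
countB {n} p = sum (map (λ w → if p w then 1 else 0) (allFin n))

deg : ∀ {n} → Graph n → Fin n → ℕ
deg G v = countB (adj G v)

-- minimum degree δ(G) (the initial value n is ≥ every degree, so for
-- n ≥ 1 this is exactly the minimum of the degrees)
δ : ∀ {n} → Graph n → ℕ
δ {n} G = foldr _⊓_ n (map (deg G) (allFin n))

record SubGraph {n : ℕ} (G : Graph n) : Set where
  field
    vtx    : Fin n → Bool
    edg    : Fin n → Fin n → Bool
    edg⊆   : ∀ u v → edg u v ≡ true → adj G u v ≡ true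
    edgSym : ∀ u v → edg u v ≡ edg v u
    edgEnd : ∀ u v → edg u v ≡ true → (vtx u ≡ true) × (vtx v ≡ true)
open SubGraph public

module _ {n : ℕ} {G : Graph n} (H : SubGraph G) where

  InV : Fin n → Set
  InV v = vtx H v ≡ true

  EdgeH : Fin n → Fin n → Set
  EdgeH u v = edg H u v ≡ true

  -- number of edges of H (unordered pairs {u,v}, counted once via u < v)
  edgeCount : ℕ
  edgeCount = sum (map (λ u → countB (λ v → (toℕ u <ᵇ toℕ v) ∧ edg H u v)) (allFin n))

  SubConnected : Set
  SubConnected = ∀ u v → InV u → InV v → Star EdgeH u v

  HasCycle : Set
  HasCycle = Σ (Fin n) λ x → Σ (List (Fin n)) λ ys →
               (2 ≤ length ys) × Unique (x ∷ ys) × Linked EdgeH ((x ∷ ys) ∷ʳ x)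

  IsTree : Set
  IsTree = SubConnected × ¬ HasCycle

  Contains3 : Fin n → Fin n → Fin n → Set
  Contains3 x y z = InV x × InV y × InV z

Distinct3 : ∀ {n} → Fin n → Fin n → Fin n → Set
Distinct3 x y z = (x ≢ y) × (x ≢ z) × (y ≢ z)

IsSTree : ∀ {n} {G : Graph n} → SubGraph G → Fin n → Fin n → Fin n → Set
IsSTree T x y z = IsTree T × Contains3 T x y z

NotInS : ∀ {n} → Fin n → Fin n → Fin n → Fin n → Set
NotInS x y z v = (v ≢ x) × (v ≢ y) × (v ≢ z)

VertexRainbow : ∀ {n k} {G : Graph n} → (Fin n → Fin k) → SubGraph G →
                Fin n → Fin n → Fin n → Set
VertexRainbow {n} c T x y z =
  ∀ (u w : Fin n) → InV T u → InV T w → NotInS x y z u → NotInS x y z w →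
  u ≢ w → c u ≢ c w

-- "rvx₃(G) ≤ k" in the sense of existence of a 3-vertex-rainbow colouring
-- with k colours; for k = 0 the paper's convention: every 3-subset S has an
-- S-tree whose vertex set is exactly S.
HasRVX3 : ∀ {n} → Graph n → ℕ → Set
HasRVX3 {n} G zero =
  ∀ x y z → Distinct3 x y z →
  ∃[ T ] (IsSTree {G = G} T x y z × (∀ v → InV T v → (v ≡ x) ⊎ (v ≡ y) ⊎ (v ≡ z)))
HasRVX3 {n} G (suc m) =
  ∃[ c ] (∀ x y z → Distinct3 x y z →
          ∃[ T ] (IsSTree {G = G} T x y z × VertexRainbow {k = suc m} c T x y z))

IsRVX3 : ∀ {n} → Graph n → ℕ → Set
IsRVX3 G k = HasRVX3 G k × (∀ j → j < k → ¬ HasRVX3 G j)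

ConnSubgraphWith : ∀ {n} → Graph n → Fin n → Fin n → Fin n → ℕ → Set
ConnSubgraphWith G x y z m =
  ∃[ H ] (SubConnected {G = G} H × Contains3 H x y z × edgeCount H ≡ m)

IsSteinerDist : ∀ {n} → Graph n → Fin n → Fin n → Fin n → ℕ → Set
IsSteinerDist G x y z m =
  ConnSubgraphWith G x y z m × (∀ m' → ConnSubgraphWith G x y z m' → m ≤ m')

IsSDiam3 : ∀ {n} → Graph n → ℕ → Set
IsSDiam3 G k =
  (∀ x y z → Distinct3 x y z → ∀ m → IsSteinerDist G x y z m → m ≤ k) ×
  (∃[ x ] ∃[ y ] ∃[ z ] (Distinct3 x y z × IsSteinerDist G x y z k))

module Submission where

-- The three conditions all say that every 3-set S = {x, y, z} is Neighbourly: each vertex of S is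
-- adjacent to another vertex of S. Then some vertex of S is adjacent to the other two, and the star
-- at it is a tree with vertex set S and two edges, while every connected subgraph containing S has
-- at least two edges; so rvx₃ = 0 and d(S) = 2. Conversely, in a tree with vertex set S every vertex
-- has a neighbour in S, and if a vertex z of S has none, every connected subgraph containing S has
-- three edges (one at z, one on which a walk towards z leaves S ∖ {z}, and one at the remaining
-- vertex), so d(S) ≥ 3. Finally deg v < n - 2 exactly when v has two non-neighbours u, w besides
-- itself, i.e. when {v, u, w} is not Neighbourly.

open import Defs hiding (sym)
open import Data.Nat
  using (ℕ; zero; suc; _+_; _≤_; _<_; _∸_; _<ᵇ_; z≤n; s≤s; _≤?_; _<?_)
open import Data.Nat.Properties
  using ( +-assoc; +-comm; +-monoʳ-≤; +-cancelˡ-≤; ≤-reflexive; ≤-trans; ≤-antisym; ≤-pred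
        ; n≤1+n; ≮⇒≥; ≰⇒>; ≤∧≢⇒<; <⇒≯; <⇒≱; <ᵇ⇒<; <⇒<ᵇ; m∸n≤m; m≤n+m∸n; m+n≤o⇒m≤o∸n
        ; m≤n+o⇒m∸n≤o; m≤n⇒m⊓o≤n; m≤n⇒o⊓m≤n; ⊓-glb; +-commutativeSemigroup; module ≤-Reasoning )
open import Algebra.Properties.CommutativeSemigroup +-commutativeSemigroup
  using (interchange; x∙yz≈y∙xz)
open import Data.Nat.Induction using (<-rec)
open import Data.Nat.ListAction using (sum)
open import Data.Fin using (Fin; toℕ)
open import Data.Fin.Properties using (_≟_; toℕ-injective; suc-injective; any?)
open import Data.Bool using (Bool; true; false; if_then_else_; _∧_; not)
open import Data.Bool.Properties using (∧-zeroʳ; ∧-identityʳ; ¬-not; T-≡)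
  renaming (_≟_ to _≟ᵇ_)
open import Data.List using (List; []; _∷_; map; allFin; length)
open import Data.List.Properties
  using (map-tabulate; map-cong; length-map; foldr-preservesᵇ; foldr-preservesᵒ)
open import Data.List.Membership.Propositional using (_∈_; _∉_)
open import Data.List.Membership.Propositional.Properties using (∈-map⁺; ∈-allFin)
open import Data.List.Relation.Unary.Any using (here; there)
import Data.List.Relation.Unary.Any as Any
open import Data.List.Relation.Unary.All using (All; []; _∷_)
import Data.List.Relation.Unary.All as All
import Data.List.Relation.Unary.All.Properties as All
open import Data.List.Relation.Unary.AllPairs using (AllPairs; []; _∷_)
import Data.List.Relation.Unary.AllPairs as AllPairs
import Data.List.Relation.Unary.AllPairs.Properties as AllPairs
open import Data.List.Relation.Unary.Linked using (_∷_; [-])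
open import Data.List.Relation.Unary.Unique.Propositional using (Unique)
open import Data.List.Relation.Binary.Permutation.Propositional
  using (_↭_; refl; prep; swap; trans; ↭-sym)
open import Data.List.Relation.Binary.Permutation.Propositional.Properties using (∈-resp-↭)
open import Data.Product using (Σ; ∃-syntax; _×_; _,_; proj₁; proj₂; uncurry)
import Data.Product as Product
open import Data.Product.Properties using (≡-dec; ,-injective)
open import Data.Sum using (_⊎_; inj₁; inj₂; [_,_]′)
import Data.Sum as Sum
open import Data.Empty using (⊥-elim)
open import Function using (_∘_; id; case_of_)
open import Function.Bundles using (_⇔_; mk⇔; Equivalence)
open import Relation.Nullary using (¬_; Dec; yes; no; does; contradiction; ¬?)
open import Relation.Nullary.Decidable
  using (dec-true; dec-false; does-⇔; decidable-stable; _×-dec_; _⊎-dec_)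
open import Relation.Binary.Definitions using (DecidableEquality)
open import Relation.Binary.PropositionalEquality as ≡
  using (_≡_; _≢_; refl; cong; cong₂; subst; module ≡-Reasoning)
open import Relation.Binary.Construct.Closure.ReflexiveTransitive using (Star; ε; _◅_; _◅◅_)

_∈?_ : ∀ {n} (x : Fin n) (xs : List (Fin n)) → Dec (x ∈ xs)
x ∈? xs = Any.any? (x ≟_) xs

does-true⇒ : ∀ {A : Set} (a? : Dec A) → does a? ≡ true → A
does-true⇒ (yes a) _ = a

indicator : Bool → ℕ
indicator b = if b then 1 else 0

sumFin : ∀ {n} → (Fin n → ℕ) → ℕ
sumFin {n} f = sum (map f (allFin n))

sumFin-suc : ∀ {n} (f : Fin (suc n) → ℕ) → sumFin f ≡ f Fin.zero + sumFin (f ∘ Fin.suc)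
sumFin-suc f =
  cong sum (≡.trans (map-tabulate id f) (cong (f Fin.zero ∷_) (≡.sym (map-tabulate id (f ∘ Fin.suc)))))

sumFin-cong : ∀ {n} {f g : Fin n → ℕ} → (∀ i → f i ≡ g i) → sumFin f ≡ sumFin g
sumFin-cong {n} f≗g = cong sum (map-cong f≗g (allFin n))

sumFin-zero : ∀ {n} {f : Fin n → ℕ} → (∀ i → f i ≡ 0) → sumFin f ≡ 0
sumFin-zero {zero} f≗0 = refl
sumFin-zero {suc n} {f} f≗0 =
  ≡.trans (sumFin-suc f) (cong₂ _+_ (f≗0 Fin.zero) (sumFin-zero (f≗0 ∘ Fin.suc)))

sumFin-update : ∀ {n} {f g : Fin n → ℕ} (a : Fin n) {k} →
                (∀ i → i ≢ a → f i ≡ g i) → f a ≡ k + g a → sumFin f ≡ k + sumFin g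
sumFin-update {suc n} {f} {g} Fin.zero {k} off at = begin
  sumFin f                            ≡⟨ sumFin-suc f ⟩
  f Fin.zero + sumFin (f ∘ Fin.suc)   ≡⟨ cong₂ _+_ at (sumFin-cong (λ i → off (Fin.suc i) λ ())) ⟩
  k + g Fin.zero + sumFin (g ∘ Fin.suc) ≡⟨ +-assoc k _ _ ⟩
  k + (g Fin.zero + sumFin (g ∘ Fin.suc)) ≡⟨ cong (k +_) (≡.sym (sumFin-suc g)) ⟩
  k + sumFin g                        ∎
  where open ≡-Reasoning
sumFin-update {suc n} {f} {g} (Fin.suc a) {k} off at = begin
  sumFin f                              ≡⟨ sumFin-suc f ⟩
  f Fin.zero + sumFin (f ∘ Fin.suc)     ≡⟨ cong₂ _+_ (off Fin.zero λ ()) (sumFin-update a off′ at) ⟩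
  g Fin.zero + (k + sumFin (g ∘ Fin.suc)) ≡⟨ x∙yz≈y∙xz (g Fin.zero) k _ ⟩
  k + (g Fin.zero + sumFin (g ∘ Fin.suc)) ≡⟨ cong (k +_) (≡.sym (sumFin-suc g)) ⟩
  k + sumFin g                          ∎
  where
  open ≡-Reasoning
  off′ : ∀ i → i ≢ a → f (Fin.suc i) ≡ g (Fin.suc i)
  off′ i i≢a = off (Fin.suc i) (i≢a ∘ suc-injective)

module _ {A : Set} (_≟_ : DecidableEquality A) where

  infixl 6 _∖_
  _∖_ : (A → Bool) → A → A → Bool
  (p ∖ a) x = p x ∧ not (does (x ≟ a))

  ∖-self : ∀ p a → (p ∖ a) a ≡ false
  ∖-self p a rewrite dec-true (a ≟ a) refl = ∧-zeroʳ (p a)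

  ∖-other : ∀ p {a x} → x ≢ a → (p ∖ a) x ≡ p x
  ∖-other p {a} {x} x≢a rewrite dec-false (x ≟ a) x≢a = ∧-identityʳ (p x)

  ∖-fresh : ∀ {p a} → p a ≡ false → ∀ x → (p ∖ a) x ≡ p x
  ∖-fresh {p} {a} pa x with x ≟ a
  ... | yes refl = ≡.trans (∧-zeroʳ (p x)) (≡.sym pa)
  ... | no _     = ∧-identityʳ (p x)

  ∖-sound : ∀ {p a x} → (p ∖ a) x ≡ true → p x ≡ true × x ≢ a
  ∖-sound {p} {a} {x} e with x ≟ a
  ... | yes _   = contradiction (≡.trans (≡.sym e) (∧-zeroʳ (p x))) λ ()
  ... | no x≢a = ≡.trans (≡.sym (∧-identityʳ (p x))) e , x≢a

  -- Abstracts countB, so that the bounds below apply to vertices and to pairs of vertices alike.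
  record IsCount (count : (A → Bool) → ℕ) : Set where
    field
      count-cong   : ∀ {p q} → (∀ a → p a ≡ q a) → count p ≡ count q
      count-empty  : ∀ {p} → (∀ a → p a ≡ false) → count p ≡ 0
      count-remove : ∀ {p a} → p a ≡ true → count p ≡ suc (count (p ∖ a))

  module IsCountProperties {count} (isCount : IsCount count) where
    open IsCount isCount public

    count≤suc-∖ : ∀ p a → count p ≤ suc (count (p ∖ a))
    count≤suc-∖ p a with p a in pa
    ... | true  = ≤-reflexive (count-remove pa)
    ... | false = ≤-trans (≤-reflexive (count-cong (λ x → ≡.sym (∖-fresh pa x)))) (n≤1+n _)

    count≤length : ∀ {p} xs → (∀ a → p a ≡ true → a ∈ xs) → count p ≤ length xs
    count≤length {p} [] cover =
      ≤-reflexive (count-empty (λ a → ¬-not (λ pa → case cover a pa of λ ())))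
    count≤length {p} (x ∷ xs) cover = ≤-trans (count≤suc-∖ p x) (s≤s (count≤length xs cover′))
      where
      cover′ : ∀ a → (p ∖ x) a ≡ true → a ∈ xs
      cover′ a e with ∖-sound {p} {x} {a} e
      ... | pa , a≢x with cover a pa
      ...   | here a≡x   = contradiction a≡x a≢x
      ...   | there a∈xs = a∈xs

    length≤count : ∀ {p xs} → Unique xs → All (λ a → p a ≡ true) xs → length xs ≤ count p
    length≤count [] [] = z≤n
    length≤count {p} (x≢xs ∷ unique) (px ∷ pxs) =
      ≤-trans (s≤s (length≤count unique (All.zipWith kept (pxs , x≢xs))))
              (≤-reflexive (≡.sym (count-remove px)))
      where
      kept : ∀ {a} → p a ≡ true × _ ≢ a → (p ∖ _) a ≡ true
      kept (pa , x≢a) = ≡.trans (∖-other p (x≢a ∘ ≡.sym)) pa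

countB-isCount : ∀ {n} → IsCount _≟_ (countB {n})
countB-isCount = record
  { count-cong   = λ p≗q → sumFin-cong (cong indicator ∘ p≗q)
  ; count-empty  = λ p≗false → sumFin-zero (cong indicator ∘ p≗false)
  ; count-remove = λ {p} {a} pa → sumFin-update {f = indicator ∘ p} {g = indicator ∘ (_∖_ _≟_ p a)} a
      (λ x x≢a → cong indicator (≡.sym (∖-other _≟_ p x≢a)))
      (≡.trans (cong indicator pa) (cong (λ b → 1 + indicator b) (≡.sym (∖-self _≟_ p a))))
  }

module CountFin {n} = IsCountProperties (_≟_ {n}) countB-isCount

countB-suc : ∀ {n} (p : Fin (suc n) → Bool) → countB p ≡ indicator (p Fin.zero) + countB (p ∘ Fin.suc)
countB-suc p = sumFin-suc (indicator ∘ p)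

countB-complement : ∀ {n} (p : Fin n → Bool) → countB p + countB (not ∘ p) ≡ n
countB-complement {zero} p = refl
countB-complement {suc n} p = begin
  countB p + countB (not ∘ p)
    ≡⟨ cong₂ _+_ (countB-suc p) (countB-suc (not ∘ p)) ⟩
  (indicator (p Fin.zero) + countB (p ∘ Fin.suc)) + (indicator (not (p Fin.zero)) + countB (not ∘ p ∘ Fin.suc))
    ≡⟨ interchange (indicator (p Fin.zero)) _ _ _ ⟩
  (indicator (p Fin.zero) + indicator (not (p Fin.zero))) + (countB (p ∘ Fin.suc) + countB (not ∘ p ∘ Fin.suc))
    ≡⟨ cong₂ _+_ (indicator-not (p Fin.zero)) (countB-complement (p ∘ Fin.suc)) ⟩
  suc n ∎
  where
  open ≡-Reasoning
  indicator-not : ∀ b → indicator b + indicator (not b) ≡ 1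
  indicator-not true  = refl
  indicator-not false = refl

countB-witness : ∀ {n} {p : Fin n → Bool} xs → length xs < countB p → ∃[ a ] (p a ≡ true × a ∉ xs)
countB-witness {p = p} xs len<count with any? (λ a → (p a ≟ᵇ true) ×-dec ¬? (a ∈? xs))
... | yes found = found
... | no none = contradiction (CountFin.count≤length xs covered) (<⇒≱ len<count)
  where
  covered : ∀ a → p a ≡ true → a ∈ xs
  covered a pa = decidable-stable (a ∈? xs) (λ a∉xs → none (a , pa , a∉xs))

pairCount : ∀ {n} → (Fin n × Fin n → Bool) → ℕ
pairCount q = sumFin (λ u → countB (λ v → q (u , v)))

_≟ₚ_ : ∀ {n} → DecidableEquality (Fin n × Fin n)
_≟ₚ_ = ≡-dec _≟_ _≟_

pairCount-isCount : ∀ {n} → IsCount (_≟ₚ_ {n}) pairCount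
pairCount-isCount {n} = record
  { count-cong   = λ q≗r → sumFin-cong (λ u → CountFin.count-cong {n} (λ v → q≗r (u , v)))
  ; count-empty  = λ q≗false → sumFin-zero (λ u → CountFin.count-empty {n} (λ v → q≗false (u , v)))
  ; count-remove = remove
  }
  where
  remove : ∀ {q} {ab : Fin n × Fin n} → q ab ≡ true → pairCount q ≡ suc (pairCount (_∖_ _≟ₚ_ q ab))
  remove {q} {a , b} qab = sumFin-update a
    (λ u u≢a → CountFin.count-cong {n} (λ v → ≡.sym (∖-other _≟ₚ_ q {a , b} {u , v} (u≢a ∘ cong proj₁))))
    (≡.trans (CountFin.count-remove {n} {λ v → q (a , v)} qab) (cong suc (CountFin.count-cong {n} row)))
    where
    row : ∀ v → (_∖_ _≟_ (λ w → q (a , w)) b) v ≡ (_∖_ _≟ₚ_ q (a , b)) (a , v)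
    row v = cong (λ d → q (a , v) ∧ not d)
                 (does-⇔ (mk⇔ (cong (a ,_)) (cong proj₂)) (v ≟ b) ((a , v) ≟ₚ (a , b)))

module CountPair {n} = IsCountProperties (_≟ₚ_ {n}) pairCount-isCount

first-step : ∀ {A : Set} {R : A → A → Set} {x y} → Star R x y → x ≢ y → ∃[ a ] R x a
first-step ε       x≢y = contradiction refl x≢y
first-step (r ◅ _) _   = _ , r

crossing-step : ∀ {A : Set} {R : A → A → Set} {P : A → Set} → (∀ a → Dec (P a)) →
                ∀ {x z} → Star R x z → P x → ¬ P z → ∃[ u ] ∃[ v ] (P u × ¬ P v × R u v)
crossing-step P? ε px ¬pz = contradiction px ¬pz
crossing-step P? (_◅_ {j = a} r rest) px ¬pz with P? a
... | yes pa = crossing-step P? rest pa ¬pz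
... | no ¬pa = _ , a , px , ¬pa , r

no-least⇒empty : (P : ℕ → Set) → (∀ m → P m → ¬ (∀ k → P k → m ≤ k)) → ∀ m → ¬ P m
no-least⇒empty P no-least = <-rec (λ m → ¬ P m)
  λ m smaller pm → no-least m pm (λ k pk → ≮⇒≥ (λ k<m → smaller k<m pk))

module _ {n : ℕ} (G : Graph n) where

  Adj-sym : ∀ {u v} → Adj G u v → Adj G v u
  Adj-sym {u} {v} a = ≡.trans (Graph.sym G v u) a

  Adj-irrefl : ∀ {v} → ¬ Adj G v v
  Adj-irrefl {v} a = case ≡.trans (≡.sym a) (irrefl G v) of λ ()

  Adj? : ∀ u v → Dec (Adj G u v)
  Adj? u v = adj G u v ≟ᵇ true

  -- v itself is counted.
  nonDeg : Fin n → ℕ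
  nonDeg v = countB (not ∘ adj G v)

  deg+nonDeg≡n : ∀ v → deg G v + nonDeg v ≡ n
  deg+nonDeg≡n v = countB-complement (adj G v)

  deg+length≤n : ∀ {v xs} → Unique xs → All (λ u → adj G v u ≡ false) xs → deg G v + length xs ≤ n
  deg+length≤n {v} {xs} unique non-adjacent = subst (deg G v + length xs ≤_) (deg+nonDeg≡n v)
    (+-monoʳ-≤ (deg G v) (CountFin.length≤count unique (All.map (cong not) non-adjacent)))

  deg≤n∸1 : ∀ v → deg G v ≤ n ∸ 1
  deg≤n∸1 v = m+n≤o⇒m≤o∸n (deg G v) (deg+length≤n ([] ∷ []) (irrefl G v ∷ []))

  n∸2≤deg⇒adjacent : ∀ {v u w} → n ∸ 2 ≤ deg G v → Distinct3 v u w → Adj G v u ⊎ Adj G v w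
  n∸2≤deg⇒adjacent {v} {u} {w} n∸2≤deg (v≢u , v≢w , u≢w) =
    decidable-stable (Adj? v u ⊎-dec Adj? v w) λ non-adjacent →
      case +-cancelˡ-≤ (deg G v) 3 2 (≤-trans (three-non-neighbours non-adjacent) n≤deg+2)
      of λ { (s≤s (s≤s ())) }
    where
    three-non-neighbours : ¬ (Adj G v u ⊎ Adj G v w) → deg G v + 3 ≤ n
    three-non-neighbours non-adjacent = deg+length≤n ((v≢u ∷ v≢w ∷ []) ∷ (u≢w ∷ []) ∷ [] ∷ [])
      (irrefl G v ∷ ¬-not (non-adjacent ∘ inj₁) ∷ ¬-not (non-adjacent ∘ inj₂) ∷ [])
    n≤deg+2 : n ≤ deg G v + 2
    n≤deg+2 = ≤-trans (m≤n+m∸n n 2) (≤-trans (+-monoʳ-≤ 2 n∸2≤deg) (≤-reflexive (+-comm 2 (deg G v))))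

  deg<n∸2⇒3≤nonDeg : ∀ {v} → ¬ (n ∸ 2 ≤ deg G v) → 3 ≤ nonDeg v
  deg<n∸2⇒3≤nonDeg {v} deg≱ with 3 ≤? nonDeg v
  ... | yes 3≤c = 3≤c
  ... | no 3≰c = contradiction (m≤n+o⇒m∸n≤o n 2 n≤2+deg) deg≱
    where
    n≤2+deg : n ≤ 2 + deg G v
    n≤2+deg = begin
      n                ≡⟨ ≡.sym (deg+nonDeg≡n v) ⟩
      deg G v + nonDeg v ≤⟨ +-monoʳ-≤ (deg G v) (≤-pred (≰⇒> 3≰c)) ⟩
      deg G v + 2      ≡⟨ +-comm (deg G v) 2 ⟩
      2 + deg G v      ∎
      where open ≤-Reasoning

  deg<n∸2⇒non-adjacent : ∀ {v} → ¬ (n ∸ 2 ≤ deg G v) →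
                          ∃[ u ] ∃[ w ] (Distinct3 v u w × ¬ (Adj G v u ⊎ Adj G v w))
  deg<n∸2⇒non-adjacent {v} deg≱
    with countB-witness (v ∷ []) (≤-trans (s≤s (s≤s z≤n)) (deg<n∸2⇒3≤nonDeg deg≱))
  ... | u , ¬vu , u∉ with countB-witness (v ∷ u ∷ []) (deg<n∸2⇒3≤nonDeg deg≱)
  ...   | w , ¬vw , w∉ =
    u , w , (u∉ ∘ here ∘ ≡.sym , w∉ ∘ here ∘ ≡.sym , w∉ ∘ there ∘ here ∘ ≡.sym) ,
    [ not-true⇒¬Adj ¬vu , not-true⇒¬Adj ¬vw ]′
    where
    not-true⇒¬Adj : ∀ {a} → not (adj G v a) ≡ true → ¬ Adj G v a
    not-true⇒¬Adj ¬va va = case ≡.trans (≡.sym (cong not va)) ¬va of λ ()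

  δ≤deg : ∀ v → δ G ≤ deg G v
  δ≤deg v = foldr-preservesᵒ {P = _≤ deg G v} (λ x y → [ m≤n⇒m⊓o≤n y , m≤n⇒o⊓m≤n x ]′) n
    (map (deg G) (allFin n)) (inj₂ (Any.map (≤-reflexive ∘ ≡.sym) (∈-map⁺ (deg G) (∈-allFin v))))

  ≤δ : ∀ {k} → k ≤ n → (∀ v → k ≤ deg G v) → k ≤ δ G
  ≤δ {k} k≤n k≤deg = foldr-preservesᵇ {P = k ≤_} ⊓-glb k≤n (All.map⁺ (All.tabulate⁺ k≤deg))

δ≤n∸1 : ∀ {n} (G : Graph n) → δ G ≤ n ∸ 1
δ≤n∸1 {zero}  G = z≤n
δ≤n∸1 {suc n} G = ≤-trans (δ≤deg G Fin.zero) (deg≤n∸1 G Fin.zero)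

-- edgeCount counts an undirected edge {u, v} once, as the ordered pair with toℕ u < toℕ v.
orient : ∀ {n} → Fin n → Fin n → Fin n × Fin n
orient a b = if toℕ a <ᵇ toℕ b then (a , b) else (b , a)

SameEnds : ∀ {n} → Fin n × Fin n → Fin n × Fin n → Set
SameEnds (a , b) (c , d) = (a ≡ c × b ≡ d) ⊎ (a ≡ d × b ≡ c)

<ᵇ-true : ∀ {m n} → m < n → (m <ᵇ n) ≡ true
<ᵇ-true {m} {n} m<n = Equivalence.to T-≡ (<⇒<ᵇ m<n)

orient-< : ∀ {n} {a b : Fin n} → toℕ a < toℕ b → orient a b ≡ (a , b)
orient-< {a = a} {b} a<b = cong (λ c → if c then (a , b) else (b , a)) (<ᵇ-true a<b)

orient-≮ : ∀ {n} {a b : Fin n} → ¬ toℕ a < toℕ b → orient a b ≡ (b , a)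
orient-≮ {a = a} {b} a≮b =
  cong (λ c → if c then (a , b) else (b , a)) (¬-not (a≮b ∘ <ᵇ⇒< _ _ ∘ Equivalence.from T-≡))

orient-cases : ∀ {n} (a b : Fin n) → orient a b ≡ (a , b) ⊎ orient a b ≡ (b , a)
orient-cases a b with toℕ a <? toℕ b
... | yes a<b = inj₁ (orient-< a<b)
... | no a≮b  = inj₂ (orient-≮ a≮b)

orient-sameEnds : ∀ {n} {a b c d : Fin n} → orient a b ≡ orient c d → SameEnds (a , b) (c , d)
orient-sameEnds {a = a} {b} {c} {d} eq with orient-cases a b | orient-cases c d
... | inj₁ p | inj₁ q = inj₁ (,-injective (≡.trans (≡.sym p) (≡.trans eq q)))
... | inj₁ p | inj₂ q = inj₂ (,-injective (≡.trans (≡.sym p) (≡.trans eq q)))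
... | inj₂ p | inj₁ q = inj₂ (Product.swap (,-injective (≡.trans (≡.sym p) (≡.trans eq q))))
... | inj₂ p | inj₂ q = inj₁ (Product.swap (,-injective (≡.trans (≡.sym p) (≡.trans eq q))))

module _ {n : ℕ} {G : Graph n} (H : SubGraph G) where

  orientedEdge : Fin n × Fin n → Bool
  orientedEdge (u , v) = (toℕ u <ᵇ toℕ v) ∧ edg H u v

  edge-irrefl : ∀ {a b} → EdgeH H a b → a ≢ b
  edge-irrefl {a} e refl = Adj-irrefl G (edg⊆ H a a e)

  edge⇒orientedEdge : ∀ {a b} → EdgeH H a b → orientedEdge (orient a b) ≡ true
  edge⇒orientedEdge {a} {b} e with toℕ a <? toℕ b
  ... | yes a<b = subst (λ ab → orientedEdge ab ≡ true) (≡.sym (orient-< a<b)) (cong₂ _∧_ (<ᵇ-true a<b) e)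
  ... | no a≮b  = subst (λ ab → orientedEdge ab ≡ true) (≡.sym (orient-≮ a≮b))
                    (cong₂ _∧_ (<ᵇ-true b<a) (≡.trans (edgSym H b a) e))
    where
    b<a : toℕ b < toℕ a
    b<a = ≤∧≢⇒< (≮⇒≥ a≮b) (edge-irrefl e ∘ toℕ-injective ∘ ≡.sym)

  orientedEdge-sound : ∀ {u v} → orientedEdge (u , v) ≡ true → toℕ u < toℕ v × EdgeH H u v
  orientedEdge-sound {u} {v} e with toℕ u <ᵇ toℕ v in u<v
  ... | true = <ᵇ⇒< _ _ (Equivalence.from T-≡ u<v) , e

  DistinctEdges : List (Fin n × Fin n) → Set
  DistinctEdges = AllPairs (λ e e′ → ¬ SameEnds e e′)

  length≤edgeCount : ∀ es → All (uncurry (EdgeH H)) es → DistinctEdges es → length es ≤ edgeCount H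
  length≤edgeCount es edges distinct = subst (_≤ edgeCount H) (length-map (uncurry orient) es)
    (CountPair.length≤count
      (AllPairs.map⁺ (AllPairs.map (λ ¬same → ¬same ∘ orient-sameEnds) distinct))
      (All.map⁺ (All.map edge⇒orientedEdge edges)))

  edgeCount≤length : ∀ ps → (∀ u v → orientedEdge (u , v) ≡ true → (u , v) ∈ ps) → edgeCount H ≤ length ps
  edgeCount≤length ps cover = CountPair.count≤length ps (λ (u , v) → cover u v)

module _ {n : ℕ} {G : Graph n} (H : SubGraph G) (connected : SubConnected H) where

  two≤edgeCount : ∀ {x y z} → Distinct3 x y z → Contains3 H x y z → 2 ≤ edgeCount H
  two≤edgeCount {x} {y} {z} (x≢y , x≢z , y≢z) (x∈ , y∈ , z∈)
    with first-step (connected y x y∈ x∈) (x≢y ∘ ≡.sym) | first-step (connected z x z∈ x∈) (x≢z ∘ ≡.sym)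
  ... | b , yb | c , zc with b ≟ z
  ...   | no b≢z = length≤edgeCount H ((y , b) ∷ (z , c) ∷ []) (yb ∷ zc ∷ []) ((distinct ∷ []) ∷ [] ∷ [])
    where
    distinct : ¬ SameEnds (y , b) (z , c)
    distinct (inj₁ (y≡z , _)) = y≢z y≡z
    distinct (inj₂ (_ , b≡z)) = b≢z b≡z
  ...   | yes refl with first-step (connected x y x∈ y∈) x≢y
  ...     | a , xa = length≤edgeCount H ((x , a) ∷ (y , z) ∷ []) (xa ∷ yb ∷ []) ((distinct ∷ []) ∷ [] ∷ [])
    where
    distinct : ¬ SameEnds (x , a) (y , z)
    distinct (inj₁ (x≡y , _)) = x≢y x≡y
    distinct (inj₂ (x≡z , _)) = x≢z x≡z

  private
    three-edges : ∀ {z x y c v b} → Distinct3 z x y → ¬ (Adj G z x ⊎ Adj G z y) → v ≢ y →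
                  EdgeH H z c → EdgeH H x v → EdgeH H y b → 3 ≤ edgeCount H
    three-edges {z} {x} {y} {c} {v} {b} (z≢x , z≢y , x≢y) z-isolated v≢y zc xv yb =
      length≤edgeCount H ((z , c) ∷ (x , v) ∷ (y , b) ∷ []) (zc ∷ xv ∷ yb ∷ [])
        ((zc≠xv ∷ zc≠yb ∷ []) ∷ (xv≠yb ∷ []) ∷ [] ∷ [])
      where
      zc≠xv : ¬ SameEnds (z , c) (x , v)
      zc≠xv (inj₁ (z≡x , _))  = z≢x z≡x
      zc≠xv (inj₂ (_ , refl)) = z-isolated (inj₁ (edg⊆ H z c zc))
      zc≠yb : ¬ SameEnds (z , c) (y , b)
      zc≠yb (inj₁ (z≡y , _))  = z≢y z≡y
      zc≠yb (inj₂ (_ , refl)) = z-isolated (inj₂ (edg⊆ H z c zc))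
      xv≠yb : ¬ SameEnds (x , v) (y , b)
      xv≠yb (inj₁ (x≡y , _)) = x≢y x≡y
      xv≠yb (inj₂ (_ , v≡y)) = v≢y v≡y

  -- A walk from x to z leaves {x, y} along some edge; together with an edge at z and an
  -- edge at the other vertex of {x, y} this gives three edges.
  three≤edgeCount : ∀ {z x y} → Distinct3 z x y → ¬ (Adj G z x ⊎ Adj G z y) → Contains3 H z x y →
                    3 ≤ edgeCount H
  three≤edgeCount {z} {x} {y} d@(z≢x , z≢y , x≢y) z-isolated (z∈ , x∈ , y∈)
    with first-step (connected z x z∈ x∈) z≢x
       | crossing-step (λ w → (w ≟ x) ⊎-dec (w ≟ y)) (connected x z x∈ z∈) (inj₁ refl) [ z≢x , z≢y ]′
  ... | c , zc | _ , v , inj₁ refl , v∉xy , xv with first-step (connected y z y∈ z∈) (z≢y ∘ ≡.sym)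
  ...   | b , yb = three-edges d z-isolated (v∉xy ∘ inj₂) zc xv yb
  three≤edgeCount {z} {x} {y} (z≢x , z≢y , x≢y) z-isolated (z∈ , x∈ , y∈)
      | c , zc | _ , v , inj₂ refl , v∉xy , yv with first-step (connected x z x∈ z∈) (z≢x ∘ ≡.sym)
  ...   | a , xa = three-edges (z≢y , z≢x , x≢y ∘ ≡.sym) (z-isolated ∘ Sum.swap) (v∉xy ∘ inj₁) zc yv xa

module _ {n : ℕ} {G : Graph n} (H : SubGraph G) (m : Fin n)
         (hub : ∀ {u v} → EdgeH H u v → u ≡ m ⊎ v ≡ m) where

  private
    middle : ∀ {a b c} → EdgeH H a b → EdgeH H b c → a ≢ c → b ≡ m
    middle ab bc a≢c with hub ab | hub bc
    ... | inj₂ b≡m | _        = b≡m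
    ... | _        | inj₁ b≡m = b≡m
    ... | inj₁ a≡m | inj₂ c≡m = contradiction (≡.trans a≡m (≡.sym c≡m)) a≢c

  -- The first two vertices y₁, y₂ after x on a cycle would both be the hub.
  through-hub⇒acyclic : ¬ HasCycle H
  through-hub⇒acyclic (_ , [] , () , _)
  through-hub⇒acyclic (_ , _ ∷ [] , s≤s () , _)
  through-hub⇒acyclic
    (x , y₁ ∷ y₂ ∷ [] , _ , (x≢y₁ ∷ x≢y₂ ∷ []) ∷ (y₁≢y₂ ∷ []) ∷ _ , xy₁ ∷ y₁y₂ ∷ y₂x ∷ [-]) =
    y₁≢y₂ (≡.trans (middle xy₁ y₁y₂ x≢y₂) (≡.sym (middle y₁y₂ y₂x (x≢y₁ ∘ ≡.sym))))
  through-hub⇒acyclic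
    (x , y₁ ∷ y₂ ∷ y₃ ∷ _ , _ , (_ ∷ x≢y₂ ∷ _) ∷ (y₁≢y₂ ∷ y₁≢y₃ ∷ _) ∷ _ , xy₁ ∷ y₁y₂ ∷ y₂y₃ ∷ _) =
    y₁≢y₂ (≡.trans (middle xy₁ y₁y₂ x≢y₂) (≡.sym (middle y₁y₂ y₂y₃ y₁≢y₃)))

module Stars {n : ℕ} (G : Graph n) (m : Fin n) (leaves : List (Fin n))
             (spokes : All (Adj G m) leaves) where

  Spoke : Fin n → Fin n → Set
  Spoke u v = (u ≡ m × v ∈ leaves) ⊎ (v ≡ m × u ∈ leaves)

  spoke? : ∀ u v → Dec (Spoke u v)
  spoke? u v = ((u ≟ m) ×-dec (v ∈? leaves)) ⊎-dec ((v ≟ m) ×-dec (u ∈? leaves))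

  spoke⇒adj : ∀ {u v} → Spoke u v → Adj G u v
  spoke⇒adj (inj₁ (refl , v∈)) = All.lookup spokes v∈
  spoke⇒adj (inj₂ (refl , u∈)) = Adj-sym G (All.lookup spokes u∈)

  star : SubGraph G
  star = record
    { vtx    = λ w → does (w ∈? (m ∷ leaves))
    ; edg    = λ u v → does (spoke? u v)
    ; edg⊆   = λ u v → spoke⇒adj ∘ does-true⇒ (spoke? u v)
    ; edgSym = λ u v → does-⇔ (mk⇔ Sum.swap Sum.swap) (spoke? u v) (spoke? v u)
    ; edgEnd = λ u v → ends ∘ does-true⇒ (spoke? u v)
    }
    where
    member : ∀ {w} → w ∈ m ∷ leaves → does (w ∈? (m ∷ leaves)) ≡ true
    member = dec-true (_ ∈? _)
    ends : ∀ {u v} → Spoke u v → does (u ∈? (m ∷ leaves)) ≡ true × does (v ∈? (m ∷ leaves)) ≡ true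
    ends (inj₁ (refl , v∈)) = member (here refl) , member (there v∈)
    ends (inj₂ (refl , u∈)) = member (there u∈) , member (here refl)

  star-vertex : ∀ {w} → InV star w ⇔ w ∈ m ∷ leaves
  star-vertex {w} = mk⇔ (does-true⇒ (w ∈? (m ∷ leaves))) (dec-true (w ∈? (m ∷ leaves)))

  star-connected : SubConnected star
  star-connected u v u∈ v∈ =
    to-hub (Equivalence.to star-vertex u∈) ◅◅ from-hub (Equivalence.to star-vertex v∈)
    where
    to-hub : ∀ {u} → u ∈ m ∷ leaves → Star (EdgeH star) u m
    to-hub (here refl) = ε
    to-hub (there u∈)  = dec-true (spoke? _ m) (inj₂ (refl , u∈)) ◅ ε
    from-hub : ∀ {v} → v ∈ m ∷ leaves → Star (EdgeH star) m v
    from-hub (here refl) = ε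
    from-hub (there v∈)  = dec-true (spoke? m _) (inj₁ (refl , v∈)) ◅ ε

  star-acyclic : ¬ HasCycle star
  star-acyclic = through-hub⇒acyclic star m (Sum.map proj₁ proj₁ ∘ does-true⇒ (spoke? _ _))

  star-edgeCount : edgeCount star ≤ length leaves
  star-edgeCount = subst (edgeCount star ≤_) (length-map (orient m) leaves) (edgeCount≤length star _ cover)
    where
    cover : ∀ u v → orientedEdge star (u , v) ≡ true → (u , v) ∈ map (orient m) leaves
    cover u v e with orientedEdge-sound star e
    ... | u<v , uv with does-true⇒ (spoke? u v) uv
    ...   | inj₁ (refl , v∈) = subst (_∈ map (orient m) leaves) (orient-< u<v) (∈-map⁺ (orient m) v∈)
    ...   | inj₂ (refl , u∈) = subst (_∈ map (orient m) leaves) (orient-≮ (<⇒≯ u<v)) (∈-map⁺ (orient m) u∈)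

∈-triple : ∀ {n} {v x y z : Fin n} → v ∈ x ∷ y ∷ z ∷ [] → v ≡ x ⊎ v ≡ y ⊎ v ≡ z
∈-triple (here v≡x)                 = inj₁ v≡x
∈-triple (there (here v≡y))         = inj₂ (inj₁ v≡y)
∈-triple (there (there (here v≡z))) = inj₂ (inj₂ v≡z)

distinct-triple : ∀ {n} → 3 ≤ n → ∃[ x ] ∃[ y ] ∃[ z ] Distinct3 {n} x y z
distinct-triple (s≤s (s≤s (s≤s _))) =
  Fin.zero , Fin.suc Fin.zero , Fin.suc (Fin.suc Fin.zero) , (λ ()) , (λ ()) , (λ ())

module _ {n : ℕ} (G : Graph n) where

  -- Equivalently, {x, y, z} induces a connected subgraph of G.
  Neighbourly : Fin n → Fin n → Fin n → Set
  Neighbourly x y z = (Adj G x y ⊎ Adj G x z) × (Adj G y x ⊎ Adj G y z) × (Adj G z x ⊎ Adj G z y)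

  AllNeighbourly : Set
  AllNeighbourly = ∀ x y z → Distinct3 x y z → Neighbourly x y z

  each-adjacent⇒neighbourly : (∀ {v u w} → Distinct3 v u w → Adj G v u ⊎ Adj G v w) → AllNeighbourly
  each-adjacent⇒neighbourly adjacent x y z (x≢y , x≢z , y≢z) =
    adjacent (x≢y , x≢z , y≢z) , adjacent (x≢y ∘ ≡.sym , y≢z , x≢z) ,
    adjacent (x≢z ∘ ≡.sym , y≢z ∘ ≡.sym , x≢y)

  neighbourly⇒hub : ∀ {x y z} → Neighbourly x y z →
    ∃[ m ] ∃[ p ] ∃[ q ] (All (Adj G m) (p ∷ q ∷ []) × m ∷ p ∷ q ∷ [] ↭ x ∷ y ∷ z ∷ [])
  neighbourly⇒hub (inj₁ xy , _ , inj₁ zx) = _ , _ , _ , xy ∷ Adj-sym G zx ∷ [] , refl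
  neighbourly⇒hub (inj₁ xy , _ , inj₂ zy) = _ , _ , _ , Adj-sym G xy ∷ Adj-sym G zy ∷ [] , swap _ _ refl
  neighbourly⇒hub (inj₂ xz , inj₁ yx , _) = _ , _ , _ , Adj-sym G yx ∷ xz ∷ [] , refl
  neighbourly⇒hub (inj₂ xz , inj₂ yz , _) =
    _ , _ , _ , Adj-sym G xz ∷ Adj-sym G yz ∷ [] , trans (swap _ _ refl) (prep _ (swap _ _ refl))

  neighbourly⇒spanning-star : ∀ {x y z} → Neighbourly x y z →
    Σ (SubGraph G) λ T → IsTree T × Contains3 T x y z ×
      (∀ v → InV T v → v ≡ x ⊎ v ≡ y ⊎ v ≡ z) × edgeCount T ≤ 2
  neighbourly⇒spanning-star nb with neighbourly⇒hub nb
  ... | m , p , q , spokes , perm =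
    star , (star-connected , star-acyclic) ,
    (contains (here refl) , contains (there (here refl)) , contains (there (there (here refl)))) ,
    (λ v → ∈-triple ∘ ∈-resp-↭ perm ∘ Equivalence.to star-vertex) ,
    star-edgeCount
    where
    open Stars G m (p ∷ q ∷ []) spokes
    contains : ∀ {v} → v ∈ _ ∷ _ ∷ _ ∷ [] → InV star v
    contains = Equivalence.from star-vertex ∘ ∈-resp-↭ (↭-sym perm)

  rvx₀⇒neighbourly : IsRVX3 G 0 → AllNeighbourly
  rvx₀⇒neighbourly (rvx₀ , _) x y z d@(x≢y , x≢z , _) with rvx₀ x y z d
  ... | T , (((connected , _) , x∈ , y∈ , z∈) , within) =
    [ ⊥-elim ∘ Adj-irrefl G , id ]′ (neighbour-in-S x∈ y∈ x≢y) ,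
    [ inj₁ , [ ⊥-elim ∘ Adj-irrefl G , inj₂ ]′ ]′ (neighbour-in-S y∈ x∈ (x≢y ∘ ≡.sym)) ,
    [ inj₁ , [ inj₂ , ⊥-elim ∘ Adj-irrefl G ]′ ]′ (neighbour-in-S z∈ x∈ (x≢z ∘ ≡.sym))
    where
    neighbour-in-S : ∀ {w w′} → InV T w → InV T w′ → w ≢ w′ → Adj G w x ⊎ Adj G w y ⊎ Adj G w z
    neighbour-in-S w∈ w′∈ w≢w′ with first-step (connected _ _ w∈ w′∈) w≢w′
    ... | a , wa with within a (proj₂ (edgEnd T _ a wa))
    ...   | inj₁ refl        = inj₁ (edg⊆ T _ _ wa)
    ...   | inj₂ (inj₁ refl) = inj₂ (inj₁ (edg⊆ T _ _ wa))
    ...   | inj₂ (inj₂ refl) = inj₂ (inj₂ (edg⊆ T _ _ wa))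

  neighbourly⇒rvx₀ : AllNeighbourly → IsRVX3 G 0
  neighbourly⇒rvx₀ nb = (λ x y z d → S-tree (nb x y z d)) , λ _ ()
    where
    S-tree : ∀ {x y z} → Neighbourly x y z →
             ∃[ T ] (IsSTree T x y z × (∀ v → InV T v → v ≡ x ⊎ v ≡ y ⊎ v ≡ z))
    S-tree nb with neighbourly⇒spanning-star nb
    ... | T , tree , contains , within , _ = T , (tree , contains) , within

  whole : SubGraph G
  whole = record { vtx = λ _ → true ; edg = adj G ; edg⊆ = λ _ _ → id ; edgSym = Graph.sym G
                 ; edgEnd = λ _ _ _ → refl , refl }

  sdiam₂⇒adjacent : Connected G → IsSDiam3 G 2 → ∀ {v u w} → Distinct3 v u w → Adj G v u ⊎ Adj G v w
  sdiam₂⇒adjacent connected (diam≤2 , _) {v} {u} {w} d =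
    decidable-stable (Adj? G v u ⊎-dec Adj? G v w) λ v-isolated →
      no-least⇒empty (ConnSubgraphWith G v u w) (not-least v-isolated) (edgeCount whole)
        (whole , (λ a b _ _ → connected a b) , (refl , refl , refl) , refl)
    where
    -- A least size of a connected subgraph containing S exists (G itself is one) and would be ≥ 3.
    not-least : ¬ (Adj G v u ⊎ Adj G v w) →
                ∀ m → ConnSubgraphWith G v u w m → ¬ (∀ k → ConnSubgraphWith G v u w k → m ≤ k)
    not-least v-isolated _ S@(H , H-connected , contains , refl) least =
      case ≤-trans (three≤edgeCount H H-connected d v-isolated contains) (diam≤2 v u w d _ (S , least))
      of λ { (s≤s (s≤s ())) }

  sdiam₂⇒neighbourly : Connected G → IsSDiam3 G 2 → AllNeighbourly
  sdiam₂⇒neighbourly connected = each-adjacent⇒neighbourly ∘ sdiam₂⇒adjacent connected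

  neighbourly⇒steinerDist₂ : ∀ {x y z} → Distinct3 x y z → Neighbourly x y z → IsSteinerDist G x y z 2
  neighbourly⇒steinerDist₂ d nb with neighbourly⇒spanning-star nb
  ... | T , (T-connected , _) , contains , _ , ≤2 =
    (T , T-connected , contains , ≤-antisym ≤2 (two≤edgeCount T T-connected d contains)) ,
    λ { _ (H , H-connected , H-contains , refl) → two≤edgeCount H H-connected d H-contains }

  neighbourly⇒sdiam₂ : 3 ≤ n → AllNeighbourly → IsSDiam3 G 2
  neighbourly⇒sdiam₂ 3≤n nb =
    (λ x y z d m (_ , least) → least 2 (proj₁ (steinerDist₂ d))) ,
    (let (x , y , z , d) = distinct-triple 3≤n in x , y , z , d , steinerDist₂ d)
    where
    steinerDist₂ : ∀ {x y z} → Distinct3 x y z → IsSteinerDist G x y z 2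
    steinerDist₂ d = neighbourly⇒steinerDist₂ d (nb _ _ _ d)

  minDegree⇒neighbourly : n ∸ 2 ≤ δ G → AllNeighbourly
  minDegree⇒neighbourly n∸2≤δ =
    each-adjacent⇒neighbourly λ {v} → n∸2≤deg⇒adjacent G (≤-trans n∸2≤δ (δ≤deg G v))

  neighbourly⇒minDegree : AllNeighbourly → n ∸ 2 ≤ δ G
  neighbourly⇒minDegree nb = ≤δ G (m∸n≤m n 2) λ v → decidable-stable (n ∸ 2 ≤? deg G v) λ deg≱ →
    let (u , w , d , v-isolated) = deg<n∸2⇒non-adjacent G deg≱ in v-isolated (proj₁ (nb v u w d))

proposition2p1 : (n : ℕ) (G : Graph n) → 3 ≤ n → Connected G →
    (IsRVX3 G 0 ⇔ IsSDiam3 G 2) × (IsSDiam3 G 2 ⇔ ((n ∸ 2 ≤ δ G) × (δ G ≤ n ∸ 1)))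
proposition2p1 n G 3≤n connected =
  mk⇔ (neighbourly⇒sdiam₂ G 3≤n ∘ rvx₀⇒neighbourly G)
      (neighbourly⇒rvx₀ G ∘ sdiam₂⇒neighbourly G connected) ,
  mk⇔ (λ diam → neighbourly⇒minDegree G (sdiam₂⇒neighbourly G connected diam) , δ≤n∸1 G)
      (neighbourly⇒sdiam₂ G 3≤n ∘ minDegree⇒neighbourly G ∘ proj₁)
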